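{- For every $K>0$ and $c_0>0$ there is $K'>0$ depending only on $K,c_0$ such that the following holds. Let $f_1,f_2:\Omega_n\to\{0,1\}$ be increasing with $\mathrm{Cov}(f_1,f_2)\le K\,\varphi(W_1(f_1,f_2))$, and let $g_1,\dots,g_n:\Omega_m\to\{0,1\}$ be increasing functions with $\mathbb{E}[g_i]=1/2$ and $\sum_{j=1}^m I_j(g_i)^2\ge c_0$ for all $i$. Let $\tilde f_\ell=f_\ell\circ(g_1,\dots,g_n):\Omega_{mn}\to\{0,1\}$ for $\ell=1,2$. Then $\mathrm{Cov}(\tilde f_1,\tilde f_2)\le K'\,\varphi(W_1(\tilde f_1,\tilde f_2))$.
   Context: $\Omega_n=\{0,1\}^n$ with the uniform measure; a function is increasing if it is non-decreasing in the coordinatewise order. $\mathrm{Cov}(f,g)=\mathbb{E}[fg]-\mathbb{E}[f]\mathbb{E}[g]$. $I_k(h)=\mathbb{E}_x|h(x)-h(x\oplus e_k)|$ ($x\oplus e_k$: flip coordinate $k$), and $W_1(h_1,h_2)=\sum_k I_k(h_1)I_k(h_2)$ (sum over all coordinates of the common domain). $\varphi(x)=x/\log(e/x)$, $\varphi(0)=0$. The composition is $f\circ(g_1,\dots,g_n)(x^1,\dots,x^n)=f(g_1(x^1),\dots,g_n(x^n))$ with $x^i\in\Omega_m$ disjoint blocks of variables. A pair satisfying $\mathrm{Cov}\le K\varphi(W_1)$ is called a tightness example for Talagrand's inequality $\mathrm{Cov}(f,g)\ge c\,\varphi(W_1(f,g))$ for increasing $f,g$.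
   Formalization: The constants K and $c_0$ range over the positive rationals, and $K'$ is taken in the positive rationals as well. -}

module Defs where

open import Data.Bool.Base using (Bool; true; false; not; if_then_else_)
import Data.Bool.Base as B
open import Data.Nat.Base as ℕ using (ℕ; zero; suc)
open import Data.Fin.Base using (Fin)
import Data.Fin.Base as F
open import Data.Vec.Base using (Vec; []; _∷_; take; drop; lookup; tabulate; updateAt)
open import Data.Vec.Relation.Binary.Pointwise.Inductive using (Pointwise)
open import Data.Integer.Base using (+_)
open import Data.Rational.Base
open import Data.Product.Base using (Σ; ∃; _×_)
open import Data.Sum.Base using (_⊎_)
open import Relation.Binary.PropositionalEquality using (_≡_)
open import Function.Base using (_∘_)

-- The discrete cube Ω_n = {0,1}^n, with 0 = false, 1 = true.
Cube : ℕ → Set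
Cube n = Vec Bool n

toℚ : Bool → ℚ
toℚ b = if b then 1ℚ else 0ℚ

𝔼 : ∀ n → (Cube n → ℚ) → ℚ
𝔼 zero    h = h []
𝔼 (suc n) h = ½ * (𝔼 n (λ x → h (false ∷ x)) + 𝔼 n (λ x → h (true ∷ x)))

_≤ᶜ_ : ∀ {n} → Cube n → Cube n → Set
_≤ᶜ_ = Pointwise B._≤_

Increasing : ∀ {n} → (Cube n → Bool) → Set
Increasing {n} f = ∀ (x y : Cube n) → x ≤ᶜ y → f x B.≤ f y

Cov : ∀ n → (Cube n → Bool) → (Cube n → Bool) → ℚ
Cov n f g = 𝔼 n (λ x → toℚ (f x) * toℚ (g x)) - 𝔼 n (toℚ ∘ f) * 𝔼 n (toℚ ∘ g)

flipAt : ∀ {n} → Fin n → Cube n → Cube n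
flipAt k x = updateAt x k not

Inf : ∀ n → (Cube n → Bool) → Fin n → ℚ
Inf n h k = 𝔼 n (λ x → ∣ toℚ (h x) - toℚ (h (flipAt k x)) ∣)

Σᶠ : ∀ n → (Fin n → ℚ) → ℚ
Σᶠ zero    a = 0ℚ
Σᶠ (suc n) a = a F.zero + Σᶠ n (a ∘ F.suc)

W₁ : ∀ n → (Cube n → Bool) → (Cube n → Bool) → ℚ
W₁ n f g = Σᶠ n (λ k → Inf n f k * Inf n g k)

blocks : ∀ n m → Cube (n ℕ.* m) → Vec (Cube m) n
blocks zero    m x = []
blocks (suc n) m x = take m x ∷ blocks n m (drop m x)

compose : ∀ n m → (Cube n → Bool) → (Fin n → Cube m → Bool) → Cube (n ℕ.* m) → Bool
compose n m f g x = f (tabulate (λ i → g i (lookup (blocks n m x) i)))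

expTerm : ℕ → ℚ → ℚ
expTerm zero    t = 1ℚ
expTerm (suc k) t = expTerm k t * t * (+ 1 / suc k)

expPartial : ℕ → ℚ → ℚ
expPartial zero    t = 1ℚ
expPartial (suc N) t = expPartial N t + expTerm (suc N) t

-- "exp a ≤ w" for rationals a, w.
-- For a ≥ 0, exp a = sup_N S_N(a).  For a < 0, exp a = 1/exp(-a), so exp a ≤ w iff
-- w > 0 and 1/w ≤ exp(-a) = sup_N S_N(-a).
ExpLE : ℚ → ℚ → Set
ExpLE a w =
  (0ℚ ≤ a × (∀ N → expPartial N a ≤ w))
  ⊎ (a < 0ℚ × Σ (0ℚ < w) (λ w>0 →
       ∀ ε → 0ℚ < ε → ∃ λ N → (1/_ w {{>-nonZero w>0}}) - ε < expPartial N (- a)))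

-- "w < e" and "e < w" where e = exp 1 = sup_N S_N(1).
LtE : ℚ → Set
LtE w = ∃ λ N → w < expPartial N 1ℚ

GtE : ℚ → Set
GtE w = Σ ℚ (λ ε → 0ℚ < ε × (∀ N → expPartial N 1ℚ + ε ≤ w))

-- φBound K w c  means  c ≤ K · φ(w)  with φ(w) = w / log(e/w), φ(0) = 0,
-- for K > 0 and w ≥ 0 (the only case used).  Writing L = log(e/w) = 1 - log w:
--  * w = 0 : φ(0) = 0, so c ≤ 0;
--  * 0 < w < e : L > 0, so for c ≤ 0 it holds, and for c > 0 it is
--      L ≤ Kw/c  ⇔  exp(1 - Kw/c) ≤ w;
--  * w > e : L < 0 and Kφ(w) < 0, so c < 0 and  c·L ≥ Kw  ⇔  exp(1 - Kw/c) ≤ w.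
--  (w = e is impossible for rational w.)
φBound : ℚ → ℚ → ℚ → Set
φBound K w c =
  (w ≡ 0ℚ × c ≤ 0ℚ)
  ⊎ (0ℚ < w × LtE w × (c ≤ 0ℚ ⊎ Σ (0ℚ < c) (λ c>0 →
        ExpLE (1ℚ - _÷_ (K * w) c {{>-nonZero c>0}}) w)))
  ⊎ (GtE w × Σ (c < 0ℚ) (λ c<0 →
        ExpLE (1ℚ - _÷_ (K * w) c {{<-nonZero c<0}}) w))

Tight : ∀ n → ℚ → (Cube n → Bool) → (Cube n → Bool) → Set
Tight n K f g = φBound K (W₁ n f g) (Cov n f g)

{-# OPTIONS --safe #-}

-- Each g_i is balanced, so x ↦ (g_i(x^i))_i pushes the uniform measure on Ω_{nm} forward to
-- the uniform measure on Ω_n.  Hence the covariance is unchanged and the influence of the j-th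
-- variable of block i factors as I_i(f)·I_j(g_i), so that
-- W₁(f̃₁, f̃₂) = Σ_i I_i(f₁) I_i(f₂) Σ_j I_j(g_i)².  For increasing h the level-one inequality
-- Σ_j I_j(h)² ≤ 1 then squeezes c₀W ≤ W̃ ≤ W ≤ 1, where W = W₁(f₁, f₂) and W̃ = W₁(f̃₁, f̃₂).
-- For 0 < W ≤ 1 and Cov > 0, Cov ≤ Kφ(W) says exp(KW/Cov − 1) ≥ 1/W.  With r = 1/c₀ and
-- K′ = K(1 + r)r the exponent grows by at least r when W is replaced by W̃, and
-- exp(x + y) ≥ (1 + y)exp(x) ≥ r·exp(x) absorbs 1/W̃ ≤ r/W.  Over ℚ, exp is only the supremum
-- of the partial sums S_N, for which (1 + y)S_N(x) ≤ S_{N+1}(x + y) plays the same role.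

module Submission where

open import Defs
open import Data.Nat.Base using (ℕ; zero; suc) renaming (_*_ to _*ℕ_; _+_ to _+ℕ_)
import Data.Nat.Properties as ℕ
import Data.Nat.Coprimality as Coprimality
open import Data.Fin.Base as F using (Fin; _↑ˡ_; _↑ʳ_)
open import Data.Bool.Base using (Bool; true; false)
import Data.Bool.Base as Bool
import Data.Bool.Properties as Bool
open import Data.Vec.Base using ([]; _∷_; take; drop; tabulate; lookup)
open import Data.Vec.Relation.Binary.Pointwise.Inductive as Pointwise using (_∷_)
open import Data.Integer.Base using (+_)
open import Data.Rational.Base
import Data.Rational.Properties as ℚ
import Data.Rational.Unnormalised.Base as ℚᵘ
import Data.Rational.Unnormalised.Properties as ℚᵘ
open import Data.Rational.Solver using (module +-*-Solver)
open import Data.Product.Base using (Σ; ∃; _×_; _,_; proj₁; proj₂)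
open import Data.Sum.Base using (inj₁; inj₂)
open import Data.Empty using (⊥-elim)
open import Function.Base using (_∘_)
open import Relation.Binary.PropositionalEquality
open import Relation.Nullary.Decidable.Core using (toWitness)

open +-*-Solver

0<1 : 0ℚ < 1ℚ
0<1 = toWitness {a? = 0ℚ ℚ.<? 1ℚ} _

0≤½ : 0ℚ ≤ ½
0≤½ = toWitness {a? = 0ℚ ℚ.≤? ½} _

≤-byDiff : ∀ {p q} d → q - p ≡ d → 0ℚ ≤ d → p ≤ q
≤-byDiff {p} {q} d q-p≡d 0≤d = subst₂ _≤_ (ℚ.+-identityʳ p) p+[q-p]≡q
  (ℚ.+-monoʳ-≤ p (subst (0ℚ ≤_) (sym q-p≡d) 0≤d))
  where
  p+[q-p]≡q : p + (q - p) ≡ q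
  p+[q-p]≡q = solve 2 (λ p q → p :+ (q :- p) := q) refl p q

<-byDiff : ∀ {p q} d → q - p ≡ d → 0ℚ < d → p < q
<-byDiff {p} {q} d q-p≡d 0<d = subst₂ _<_ (ℚ.+-identityʳ p) p+[q-p]≡q
  (ℚ.+-monoʳ-< p (subst (0ℚ <_) (sym q-p≡d) 0<d))
  where
  p+[q-p]≡q : p + (q - p) ≡ q
  p+[q-p]≡q = solve 2 (λ p q → p :+ (q :- p) := q) refl p q

p≤q⇒0≤q-p : ∀ {p q} → p ≤ q → 0ℚ ≤ q - p
p≤q⇒0≤q-p {p} {q} p≤q = subst (_≤ q - p) (ℚ.+-inverseʳ p) (ℚ.+-monoˡ-≤ (- p) p≤q)

+-nonNeg : ∀ {p q} → 0ℚ ≤ p → 0ℚ ≤ q → 0ℚ ≤ p + q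
+-nonNeg = ℚ.+-mono-≤

*-nonNeg : ∀ {p q} → 0ℚ ≤ p → 0ℚ ≤ q → 0ℚ ≤ p * q
*-nonNeg {p} {q} 0≤p 0≤q = subst (_≤ p * q) (ℚ.*-zeroʳ p) (ℚ.*-monoˡ-≤-nonNeg p {{nonNegative 0≤p}} 0≤q)

*-pos : ∀ {p q} → 0ℚ < p → 0ℚ < q → 0ℚ < p * q
*-pos {p} {q} 0<p 0<q = subst (_< p * q) (ℚ.*-zeroʳ p) (ℚ.*-monoʳ-<-pos p {{positive 0<p}} 0<q)

square-nonNeg : ∀ p → 0ℚ ≤ p * p
square-nonNeg p with ℚ.≤-total 0ℚ p
... | inj₁ 0≤p = *-nonNeg 0≤p 0≤p
... | inj₂ p≤0 = subst (0ℚ ≤_) (solve 1 (λ p → (:- p) :* (:- p) := p :* p) refl p)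
                   (*-nonNeg (ℚ.neg-antimono-≤ p≤0) (ℚ.neg-antimono-≤ p≤0))

*≤½[sq+sq] : ∀ a b → a * b ≤ ½ * (a * a) + ½ * (b * b)
*≤½[sq+sq] a b = ≤-byDiff (½ * ((a - b) * (a - b)))
  (solve 2 (λ a b → con ½ :* (a :* a) :+ con ½ :* (b :* b) :- a :* b := con ½ :* ((a :- b) :* (a :- b)))
     refl a b)
  (*-nonNeg 0≤½ (square-nonNeg (a - b)))

mean²≤½[sq+sq] : ∀ a b → (½ * (a + b)) * (½ * (a + b)) ≤ ½ * (a * a) + ½ * (b * b)
mean²≤½[sq+sq] a b = ≤-byDiff (½ * ½ * ((a - b) * (a - b)))
  (solve 2 (λ a b → con ½ :* (a :* a) :+ con ½ :* (b :* b) :- (con ½ :* (a :+ b)) :* (con ½ :* (a :+ b))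
              := con ½ :* con ½ :* ((a :- b) :* (a :- b)))
     refl a b)
  (*-nonNeg (*-nonNeg 0≤½ 0≤½) (square-nonNeg (a - b)))

1/-pos : ∀ {p} (0<p : 0ℚ < p) → 0ℚ < (1/ p) {{>-nonZero 0<p}}
1/-pos {p} 0<p = ℚ.positive⁻¹ _ {{ℚ.1/pos⇒pos p {{positive 0<p}}}}

1/-≤ : ∀ {p q} (0<p : 0ℚ < p) → 1ℚ ≤ p * q → (1/ p) {{>-nonZero 0<p}} ≤ q
1/-≤ {p} {q} 0<p 1≤pq = begin
    p⁻¹            ≡⟨ ℚ.*-identityʳ p⁻¹ ⟨
    p⁻¹ * 1ℚ       ≤⟨ ℚ.*-monoˡ-≤-nonNeg p⁻¹ {{nonNegative (ℚ.<⇒≤ (1/-pos 0<p))}} 1≤pq ⟩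
    p⁻¹ * (p * q)  ≡⟨ ℚ.*-assoc p⁻¹ p q ⟨
    p⁻¹ * p * q    ≡⟨ cong (_* q) (ℚ.*-inverseˡ p {{>-nonZero 0<p}}) ⟩
    1ℚ * q         ≡⟨ ℚ.*-identityˡ q ⟩
    q              ∎
  where
  open ℚ.≤-Reasoning
  p⁻¹ = (1/ p) {{>-nonZero 0<p}}

*≤⇒≤1/* : ∀ {c p q} (0<c : 0ℚ < c) → c * p ≤ q → p ≤ (1/ c) {{>-nonZero 0<c}} * q
*≤⇒≤1/* {c} {p} {q} 0<c cp≤q = begin
  p               ≡⟨ ℚ.*-identityˡ p ⟨
  1ℚ * p          ≡⟨ cong (_* p) (ℚ.*-inverseˡ c {{>-nonZero 0<c}}) ⟨
  c⁻¹ * c * p     ≡⟨ ℚ.*-assoc c⁻¹ c p ⟩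
  c⁻¹ * (c * p)   ≤⟨ ℚ.*-monoˡ-≤-nonNeg c⁻¹ {{nonNegative (ℚ.<⇒≤ (1/-pos 0<c))}} cp≤q ⟩
  c⁻¹ * q         ∎
  where
  open ℚ.≤-Reasoning
  c⁻¹ = (1/ c) {{>-nonZero 0<c}}

≤*⇒pos : ∀ {p q r} → 0ℚ < r → 0ℚ < p → p ≤ r * q → 0ℚ < q
≤*⇒pos {p} {q} {r} 0<r 0<p p≤rq = ℚ.*-cancelˡ-<-nonNeg r {{nonNegative (ℚ.<⇒≤ 0<r)}}
  (subst (_< r * q) (sym (ℚ.*-zeroʳ r)) (ℚ.<-≤-trans 0<p p≤rq))

1/≤*1/ : ∀ {p q r} (0<p : 0ℚ < p) (0<q : 0ℚ < q) → p ≤ r * q →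
  (1/ q) {{>-nonZero 0<q}} ≤ r * (1/ p) {{>-nonZero 0<p}}
1/≤*1/ {p} {q} {r} 0<p 0<q p≤rq = 1/-≤ 0<q (≤-byDiff (p⁻¹ * (r * q - p))
  (begin
    q * (r * p⁻¹) - 1ℚ      ≡⟨ cong (λ z → q * (r * p⁻¹) - z) (ℚ.*-inverseʳ p {{>-nonZero 0<p}}) ⟨
    q * (r * p⁻¹) - p * p⁻¹ ≡⟨ solve 4 (λ q r p p⁻¹ → q :* (r :* p⁻¹) :- p :* p⁻¹ := p⁻¹ :* (r :* q :- p))
                                  refl q r p p⁻¹ ⟩
    p⁻¹ * (r * q - p)       ∎)
  (*-nonNeg (ℚ.<⇒≤ (1/-pos 0<p)) (p≤q⇒0≤q-p p≤rq)))
  where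
  open ≡-Reasoning
  p⁻¹ = (1/ p) {{>-nonZero 0<p}}

-- Expectation and finite sums

𝔼-cong : ∀ n {h h′ : Cube n → ℚ} → (∀ x → h x ≡ h′ x) → 𝔼 n h ≡ 𝔼 n h′
𝔼-cong zero    h≡h′ = h≡h′ []
𝔼-cong (suc n) h≡h′ = cong₂ (λ a b → ½ * (a + b))
  (𝔼-cong n (λ x → h≡h′ (false ∷ x))) (𝔼-cong n (λ x → h≡h′ (true ∷ x)))

𝔼-const : ∀ n c → 𝔼 n (λ _ → c) ≡ c
𝔼-const zero    c = refl
𝔼-const (suc n) c = trans (cong (λ a → ½ * (a + a)) (𝔼-const n c))
  (solve 1 (λ c → con ½ :* (c :+ c) := c) refl c)

𝔼-+ : ∀ n (h h′ : Cube n → ℚ) → 𝔼 n (λ x → h x + h′ x) ≡ 𝔼 n h + 𝔼 n h′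
𝔼-+ zero    h h′ = refl
𝔼-+ (suc n) h h′ = trans
  (cong₂ (λ a b → ½ * (a + b)) (𝔼-+ n (λ x → h (false ∷ x)) _) (𝔼-+ n (λ x → h (true ∷ x)) _))
  (solve 4 (λ a b c d → con ½ :* ((a :+ b) :+ (c :+ d)) := con ½ :* (a :+ c) :+ con ½ :* (b :+ d))
     refl (𝔼 n (λ x → h (false ∷ x))) (𝔼 n (λ x → h′ (false ∷ x)))
          (𝔼 n (λ x → h (true ∷ x))) (𝔼 n (λ x → h′ (true ∷ x))))

𝔼-- : ∀ n (h h′ : Cube n → ℚ) → 𝔼 n (λ x → h x - h′ x) ≡ 𝔼 n h - 𝔼 n h′
𝔼-- zero    h h′ = refl
𝔼-- (suc n) h h′ = trans
  (cong₂ (λ a b → ½ * (a + b)) (𝔼-- n (λ x → h (false ∷ x)) (λ x → h′ (false ∷ x)))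
                               (𝔼-- n (λ x → h (true ∷ x)) (λ x → h′ (true ∷ x))))
  (solve 4 (λ a b c d → con ½ :* ((a :- b) :+ (c :- d)) := con ½ :* (a :+ c) :- con ½ :* (b :+ d))
     refl (𝔼 n (λ x → h (false ∷ x))) (𝔼 n (λ x → h′ (false ∷ x)))
          (𝔼 n (λ x → h (true ∷ x))) (𝔼 n (λ x → h′ (true ∷ x))))

𝔼-*ˡ : ∀ n a (h : Cube n → ℚ) → 𝔼 n (λ x → a * h x) ≡ a * 𝔼 n h
𝔼-*ˡ zero    a h = refl
𝔼-*ˡ (suc n) a h = trans
  (cong₂ (λ u v → ½ * (u + v)) (𝔼-*ˡ n a (λ x → h (false ∷ x))) (𝔼-*ˡ n a (λ x → h (true ∷ x))))
  (solve 3 (λ a u v → con ½ :* (a :* u :+ a :* v) := a :* (con ½ :* (u :+ v)))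
     refl a (𝔼 n (λ x → h (false ∷ x))) (𝔼 n (λ x → h (true ∷ x))))

𝔼-affine : ∀ n a b (h : Cube n → ℚ) → 𝔼 n (λ x → a + b * h x) ≡ a + b * 𝔼 n h
𝔼-affine n a b h = begin
  𝔼 n (λ x → a + b * h x)            ≡⟨ 𝔼-+ n (λ _ → a) (λ x → b * h x) ⟩
  𝔼 n (λ _ → a) + 𝔼 n (λ x → b * h x) ≡⟨ cong₂ _+_ (𝔼-const n a) (𝔼-*ˡ n b h) ⟩
  a + b * 𝔼 n h                      ∎
  where open ≡-Reasoning

𝔼-mono : ∀ n {h h′ : Cube n → ℚ} → (∀ x → h x ≤ h′ x) → 𝔼 n h ≤ 𝔼 n h′
𝔼-mono zero    h≤h′ = h≤h′ []
𝔼-mono (suc n) h≤h′ = ℚ.*-monoˡ-≤-nonNeg ½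
  (ℚ.+-mono-≤ (𝔼-mono n (λ x → h≤h′ (false ∷ x))) (𝔼-mono n (λ x → h≤h′ (true ∷ x))))

𝔼-nonNeg : ∀ n {h : Cube n → ℚ} → (∀ x → 0ℚ ≤ h x) → 0ℚ ≤ 𝔼 n h
𝔼-nonNeg n {h} 0≤h = subst (_≤ 𝔼 n h) (𝔼-const n 0ℚ) (𝔼-mono n 0≤h)

𝔼-take-drop : ∀ m k (H : Cube m → Cube k → ℚ) →
  𝔼 (m +ℕ k) (λ x → H (take m x) (drop m x)) ≡ 𝔼 m (λ u → 𝔼 k (H u))
𝔼-take-drop zero    k H = refl
𝔼-take-drop (suc m) k H = cong₂ (λ a b → ½ * (a + b))
  (𝔼-take-drop m k (λ u → H (false ∷ u))) (𝔼-take-drop m k (λ u → H (true ∷ u)))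

𝔼-∘-Bool : ∀ m (h : Cube m → Bool) (G : Bool → ℚ) →
  𝔼 m (G ∘ h) ≡ G false + (G true - G false) * 𝔼 m (toℚ ∘ h)
𝔼-∘-Bool m h G = trans (𝔼-cong m (G-affine ∘ h)) (𝔼-affine m (G false) (G true - G false) (toℚ ∘ h))
  where
  G-affine : ∀ b → G b ≡ G false + (G true - G false) * toℚ b
  G-affine false = solve 2 (λ a b → a := a :+ (b :- a) :* con 0ℚ) refl (G false) (G true)
  G-affine true  = solve 2 (λ a b → b := a :+ (b :- a) :* con 1ℚ) refl (G false) (G true)

𝔼-∘-balanced : ∀ m (h : Cube m → Bool) (G : Bool → ℚ) → 𝔼 m (toℚ ∘ h) ≡ ½ →
  𝔼 m (G ∘ h) ≡ ½ * (G false + G true)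
𝔼-∘-balanced m h G 𝔼h≡½ = begin
  𝔼 m (G ∘ h)                                  ≡⟨ 𝔼-∘-Bool m h G ⟩
  G false + (G true - G false) * 𝔼 m (toℚ ∘ h) ≡⟨ cong (λ p → G false + (G true - G false) * p) 𝔼h≡½ ⟩
  G false + (G true - G false) * ½             ≡⟨ solve 2 (λ a b → a :+ (b :- a) :* con ½ := con ½ :* (a :+ b))
                                                     refl (G false) (G true) ⟩
  ½ * (G false + G true)                       ∎
  where open ≡-Reasoning

Σᶠ-cong : ∀ n {a b : Fin n → ℚ} → (∀ i → a i ≡ b i) → Σᶠ n a ≡ Σᶠ n b
Σᶠ-cong zero    a≡b = refl
Σᶠ-cong (suc n) a≡b = cong₂ _+_ (a≡b F.zero) (Σᶠ-cong n (a≡b ∘ F.suc))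

Σᶠ-mono : ∀ n {a b : Fin n → ℚ} → (∀ i → a i ≤ b i) → Σᶠ n a ≤ Σᶠ n b
Σᶠ-mono zero    a≤b = ℚ.≤-refl
Σᶠ-mono (suc n) a≤b = ℚ.+-mono-≤ (a≤b F.zero) (Σᶠ-mono n (a≤b ∘ F.suc))

Σᶠ-nonNeg : ∀ n {a : Fin n → ℚ} → (∀ i → 0ℚ ≤ a i) → 0ℚ ≤ Σᶠ n a
Σᶠ-nonNeg zero    0≤a = ℚ.≤-refl
Σᶠ-nonNeg (suc n) 0≤a = +-nonNeg (0≤a F.zero) (Σᶠ-nonNeg n (0≤a ∘ F.suc))

Σᶠ-+ : ∀ n (a b : Fin n → ℚ) → Σᶠ n (λ i → a i + b i) ≡ Σᶠ n a + Σᶠ n b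
Σᶠ-+ zero    a b = refl
Σᶠ-+ (suc n) a b = trans (cong (_+_ (a F.zero + b F.zero)) (Σᶠ-+ n (a ∘ F.suc) (b ∘ F.suc)))
  (solve 4 (λ a b s t → a :+ b :+ (s :+ t) := (a :+ s) :+ (b :+ t))
     refl (a F.zero) (b F.zero) (Σᶠ n (a ∘ F.suc)) (Σᶠ n (b ∘ F.suc)))

Σᶠ-*ˡ : ∀ n c (a : Fin n → ℚ) → Σᶠ n (λ i → c * a i) ≡ c * Σᶠ n a
Σᶠ-*ˡ zero    c a = sym (ℚ.*-zeroʳ c)
Σᶠ-*ˡ (suc n) c a = trans (cong (_+_ (c * a F.zero)) (Σᶠ-*ˡ n c (a ∘ F.suc)))
  (sym (ℚ.*-distribˡ-+ c (a F.zero) _))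

Σᶠ-½+½ : ∀ n (a b : Fin n → ℚ) → Σᶠ n (λ i → ½ * a i + ½ * b i) ≡ ½ * Σᶠ n a + ½ * Σᶠ n b
Σᶠ-½+½ n a b = trans (Σᶠ-+ n (λ i → ½ * a i) (λ i → ½ * b i)) (cong₂ _+_ (Σᶠ-*ˡ n ½ a) (Σᶠ-*ˡ n ½ b))

Σᶠ-*-lower : ∀ n c (x s : Fin n → ℚ) → (∀ i → 0ℚ ≤ x i) → (∀ i → c ≤ s i) →
  c * Σᶠ n x ≤ Σᶠ n (λ i → x i * s i)
Σᶠ-*-lower n c x s 0≤x c≤s = subst (_≤ Σᶠ n (λ i → x i * s i)) (Σᶠ-*ˡ n c x) (Σᶠ-mono n (λ i → begin
  c * x i    ≤⟨ ℚ.*-monoʳ-≤-nonNeg (x i) {{nonNegative (0≤x i)}} (c≤s i) ⟩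
  s i * x i  ≡⟨ ℚ.*-comm (s i) (x i) ⟩
  x i * s i  ∎))
  where open ℚ.≤-Reasoning

Σᶠ-*-upper : ∀ n (x s : Fin n → ℚ) → (∀ i → 0ℚ ≤ x i) → (∀ i → s i ≤ 1ℚ) →
  Σᶠ n (λ i → x i * s i) ≤ Σᶠ n x
Σᶠ-*-upper n x s 0≤x s≤1 = Σᶠ-mono n (λ i → begin
  x i * s i  ≤⟨ ℚ.*-monoˡ-≤-nonNeg (x i) {{nonNegative (0≤x i)}} (s≤1 i) ⟩
  x i * 1ℚ   ≡⟨ ℚ.*-identityʳ (x i) ⟩
  x i        ∎)
  where open ℚ.≤-Reasoning

Σᶠ-↑ : ∀ m k (a : Fin (m +ℕ k) → ℚ) →
  Σᶠ (m +ℕ k) a ≡ Σᶠ m (λ i → a (i ↑ˡ k)) + Σᶠ k (λ j → a (m ↑ʳ j))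
Σᶠ-↑ zero    k a = sym (ℚ.+-identityˡ _)
Σᶠ-↑ (suc m) k a = trans (cong (_+_ (a F.zero)) (Σᶠ-↑ m k (a ∘ F.suc))) (sym (ℚ.+-assoc (a F.zero) _ _))

-- Influences and the level-one inequality

Dist : ∀ n → (Cube n → Bool) → (Cube n → Bool) → ℚ
Dist n h h′ = 𝔼 n (λ x → ∣ toℚ (h x) - toℚ (h′ x) ∣)

Dist-sym : ∀ n (h h′ : Cube n → Bool) → Dist n h h′ ≡ Dist n h′ h
Dist-sym n h h′ = 𝔼-cong n (λ x → ∣p-q∣≡∣q-p∣ (toℚ (h x)) (toℚ (h′ x)))
  where
  ∣p-q∣≡∣q-p∣ : ∀ p q → ∣ p - q ∣ ≡ ∣ q - p ∣
  ∣p-q∣≡∣q-p∣ p q = trans (cong ∣_∣ (solve 2 (λ p q → p :- q := :- (q :- p)) refl p q)) (ℚ.∣-p∣≡∣p∣ (q - p))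

Dist-self : ∀ n (h : Cube n → Bool) → Dist n h h ≡ 0ℚ
Dist-self n h = trans (𝔼-cong n (λ x → cong ∣_∣ (ℚ.+-inverseʳ (toℚ (h x))))) (𝔼-const n 0ℚ)

Dist-≤ : ∀ n (h h′ : Cube n → Bool) → (∀ x → h x Bool.≤ h′ x) →
  Dist n h h′ ≡ 𝔼 n (toℚ ∘ h′) - 𝔼 n (toℚ ∘ h)
Dist-≤ n h h′ h≤h′ = trans (𝔼-cong n (λ x → ∣toℚ-toℚ∣ (h≤h′ x))) (𝔼-- n (toℚ ∘ h′) (toℚ ∘ h))
  where
  ∣toℚ-toℚ∣ : ∀ {b b′} → b Bool.≤ b′ → ∣ toℚ b - toℚ b′ ∣ ≡ toℚ b′ - toℚ b
  ∣toℚ-toℚ∣ {false} Bool.b≤b = refl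
  ∣toℚ-toℚ∣ {true}  Bool.b≤b = refl
  ∣toℚ-toℚ∣ Bool.f≤t = refl

Inf-zero≡Dist : ∀ n (f : Cube (suc n) → Bool) →
  Inf (suc n) f F.zero ≡ Dist n (f ∘ (false ∷_)) (f ∘ (true ∷_))
Inf-zero≡Dist n f = begin
  ½ * (Dist n f₀ f₁ + Dist n f₁ f₀)  ≡⟨ cong (λ d → ½ * (Dist n f₀ f₁ + d)) (Dist-sym n f₁ f₀) ⟩
  ½ * (Dist n f₀ f₁ + Dist n f₀ f₁)  ≡⟨ solve 1 (λ d → con ½ :* (d :+ d) := d) refl (Dist n f₀ f₁) ⟩
  Dist n f₀ f₁                       ∎
  where
  open ≡-Reasoning
  f₀ = f ∘ (false ∷_)
  f₁ = f ∘ (true ∷_)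

Dist-cofactors : ∀ n (f : Cube (suc n) → Bool) b b′ →
  Dist n (f ∘ (b ∷_)) (f ∘ (b′ ∷_)) ≡ Inf (suc n) f F.zero * ∣ toℚ b - toℚ b′ ∣
Dist-cofactors n f false false = trans (Dist-self n (f ∘ (false ∷_))) (sym (ℚ.*-zeroʳ (Inf (suc n) f F.zero)))
Dist-cofactors n f true  true  = trans (Dist-self n (f ∘ (true ∷_)))  (sym (ℚ.*-zeroʳ (Inf (suc n) f F.zero)))
Dist-cofactors n f false true  = sym (trans (ℚ.*-identityʳ _) (Inf-zero≡Dist n f))
Dist-cofactors n f true  false = trans (Dist-sym n (f ∘ (true ∷_)) (f ∘ (false ∷_)))
  (sym (trans (ℚ.*-identityʳ _) (Inf-zero≡Dist n f)))

Inf-nonNeg : ∀ n (h : Cube n → Bool) k → 0ℚ ≤ Inf n h k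
Inf-nonNeg n h k = 𝔼-nonNeg n (λ x → ℚ.0≤∣p∣ _)

W₁-nonNeg : ∀ n (f g : Cube n → Bool) → 0ℚ ≤ W₁ n f g
W₁-nonNeg n f g = Σᶠ-nonNeg n (λ k → *-nonNeg (Inf-nonNeg n f k) (Inf-nonNeg n g k))

W₁≤½[W₁+W₁] : ∀ n (f g : Cube n → Bool) → W₁ n f g ≤ ½ * W₁ n f f + ½ * W₁ n g g
W₁≤½[W₁+W₁] n f g = ℚ.≤-trans
  (Σᶠ-mono n (λ k → *≤½[sq+sq] (Inf n f k) (Inf n g k)))
  (ℚ.≤-reflexive (Σᶠ-½+½ n (λ k → Inf n f k * Inf n f k) (λ k → Inf n g k * Inf n g k)))

cofactor-≤ : ∀ {n} {h : Cube (suc n) → Bool} → Increasing h → ∀ x → h (false ∷ x) Bool.≤ h (true ∷ x)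
cofactor-≤ h↑ x = h↑ _ _ (Bool.f≤t ∷ Pointwise.refl Bool.≤-refl)

cofactor-increasing : ∀ {n} {h : Cube (suc n) → Bool} → Increasing h → ∀ b → Increasing (h ∘ (b ∷_))
cofactor-increasing h↑ b x y x≤y = h↑ _ _ (Bool.≤-refl ∷ x≤y)

Inf-zero-increasing : ∀ n (h : Cube (suc n) → Bool) → Increasing h →
  Inf (suc n) h F.zero ≡ 𝔼 n (toℚ ∘ h ∘ (true ∷_)) - 𝔼 n (toℚ ∘ h ∘ (false ∷_))
Inf-zero-increasing n h h↑ = trans (Inf-zero≡Dist n h)
  (Dist-≤ n (h ∘ (false ∷_)) (h ∘ (true ∷_)) (cofactor-≤ h↑))

bias : ∀ n → (Cube n → Bool) → ℚ
bias n h = 𝔼 n (toℚ ∘ h) + 𝔼 n (toℚ ∘ h) - 1ℚ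

-- Parseval restricted to levels 0 and 1: for increasing h, I_k(h) is the k-th level-one
-- Fourier coefficient of 2h − 1, and bias n h is its mean.
W₁-self+bias²≤1 : ∀ n (h : Cube n → Bool) → Increasing h → W₁ n h h + bias n h * bias n h ≤ 1ℚ
W₁-self+bias²≤1 zero    h h↑ with h []
... | false = ℚ.≤-refl
... | true  = ℚ.≤-refl
W₁-self+bias²≤1 (suc n) h h↑ = begin
  I₀ * I₀ + Σᶠ n (λ j → (½ * (a j + b j)) * (½ * (a j + b j))) + β * β
    ≤⟨ ℚ.+-monoˡ-≤ (β * β) (ℚ.+-monoʳ-≤ (I₀ * I₀) (Σᶠ-mono n (λ j → mean²≤½[sq+sq] (a j) (b j)))) ⟩
  I₀ * I₀ + Σᶠ n (λ j → ½ * (a j * a j) + ½ * (b j * b j)) + β * β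
    ≡⟨ cong (λ s → I₀ * I₀ + s + β * β) (Σᶠ-½+½ n (λ j → a j * a j) (λ j → b j * b j)) ⟩
  I₀ * I₀ + (½ * W₁ n h₀ h₀ + ½ * W₁ n h₁ h₁) + β * β
    ≡⟨ cong (λ i → i * i + (½ * W₁ n h₀ h₀ + ½ * W₁ n h₁ h₁) + β * β) (Inf-zero-increasing n h h↑) ⟩
  (p₁ - p₀) * (p₁ - p₀) + (½ * W₁ n h₀ h₀ + ½ * W₁ n h₁ h₁) + β * β
    ≡⟨ solve 4 (λ p₀ p₁ w₀ w₁ →
          let β  = con ½ :* (p₀ :+ p₁) :+ con ½ :* (p₀ :+ p₁) :- con 1ℚ
              β₀ = p₀ :+ p₀ :- con 1ℚ
              β₁ = p₁ :+ p₁ :- con 1ℚ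
          in (p₁ :- p₀) :* (p₁ :- p₀) :+ (con ½ :* w₀ :+ con ½ :* w₁) :+ β :* β
             := con ½ :* (w₀ :+ β₀ :* β₀) :+ con ½ :* (w₁ :+ β₁ :* β₁))
         refl p₀ p₁ (W₁ n h₀ h₀) (W₁ n h₁ h₁) ⟩
  ½ * (W₁ n h₀ h₀ + bias n h₀ * bias n h₀) + ½ * (W₁ n h₁ h₁ + bias n h₁ * bias n h₁)
    ≤⟨ ℚ.+-mono-≤ (ℚ.*-monoˡ-≤-nonNeg ½ (W₁-self+bias²≤1 n h₀ (cofactor-increasing h↑ false)))
                  (ℚ.*-monoˡ-≤-nonNeg ½ (W₁-self+bias²≤1 n h₁ (cofactor-increasing h↑ true))) ⟩
  ½ * 1ℚ + ½ * 1ℚ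
    ≡⟨⟩
  1ℚ
    ∎
  where
  open ℚ.≤-Reasoning
  h₀ = h ∘ (false ∷_)
  h₁ = h ∘ (true ∷_)
  p₀ = 𝔼 n (toℚ ∘ h₀)
  p₁ = 𝔼 n (toℚ ∘ h₁)
  I₀ = Inf (suc n) h F.zero
  β = bias (suc n) h
  a b : Fin n → ℚ
  a = Inf n h₀
  b = Inf n h₁

W₁-self≤1 : ∀ n (h : Cube n → Bool) → Increasing h → W₁ n h h ≤ 1ℚ
W₁-self≤1 n h h↑ = ℚ.≤-trans
  (subst (_≤ W₁ n h h + bias n h * bias n h) (ℚ.+-identityʳ (W₁ n h h))
     (ℚ.+-monoʳ-≤ (W₁ n h h) (square-nonNeg (bias n h))))
  (W₁-self+bias²≤1 n h h↑)

W₁≤1 : ∀ n (f g : Cube n → Bool) → Increasing f → Increasing g → W₁ n f g ≤ 1ℚ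
W₁≤1 n f g f↑ g↑ = ℚ.≤-trans (W₁≤½[W₁+W₁] n f g)
  (ℚ.+-mono-≤ (ℚ.*-monoˡ-≤-nonNeg ½ (W₁-self≤1 n f f↑)) (ℚ.*-monoˡ-≤-nonNeg ½ (W₁-self≤1 n g g↑)))

-- Block composition

Balanced : ∀ {m} → (Cube m → Bool) → Set
Balanced {m} h = 𝔼 m (toℚ ∘ h) ≡ ½

-- compose n m f g reduces to f ∘ blockwise n m g, and blockwise (suc n) m g x
-- to g zero (take m x) ∷ blockwise n m (g ∘ suc) (drop m x).
blockwise : ∀ n m → (Fin n → Cube m → Bool) → Cube (n *ℕ m) → Cube n
blockwise n m g x = tabulate (λ i → g i (lookup (blocks n m x) i))

𝔼-blockwise : ∀ n m (g : Fin n → Cube m → Bool) → (∀ i → Balanced (g i)) →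
  (F : Cube n → ℚ) → 𝔼 (n *ℕ m) (F ∘ blockwise n m g) ≡ 𝔼 n F
𝔼-blockwise zero    m g g-bal F = refl
𝔼-blockwise (suc n) m g g-bal F = begin
  𝔼 (m +ℕ n *ℕ m) (λ x → F (g₀ (take m x) ∷ gs (drop m x)))
    ≡⟨ 𝔼-take-drop m (n *ℕ m) (λ u v → F (g₀ u ∷ gs v)) ⟩
  𝔼 m (λ u → 𝔼 (n *ℕ m) (λ v → F (g₀ u ∷ gs v)))
    ≡⟨ 𝔼-cong m (λ u → 𝔼-blockwise n m (g ∘ F.suc) (g-bal ∘ F.suc) (F ∘ (g₀ u ∷_))) ⟩
  𝔼 m (λ u → 𝔼 n (F ∘ (g₀ u ∷_)))
    ≡⟨ 𝔼-∘-balanced m g₀ (λ b → 𝔼 n (F ∘ (b ∷_))) (g-bal F.zero) ⟩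
  𝔼 (suc n) F
    ∎
  where
  open ≡-Reasoning
  g₀ = g F.zero
  gs = blockwise n m (g ∘ F.suc)

Cov-compose : ∀ n m f₁ f₂ (g : Fin n → Cube m → Bool) → (∀ i → Balanced (g i)) →
  Cov (n *ℕ m) (compose n m f₁ g) (compose n m f₂ g) ≡ Cov n f₁ f₂
Cov-compose n m f₁ f₂ g g-bal = cong₂ _-_
  (𝔼-blockwise n m g g-bal (λ y → toℚ (f₁ y) * toℚ (f₂ y)))
  (cong₂ _*_ (𝔼-blockwise n m g g-bal (toℚ ∘ f₁)) (𝔼-blockwise n m g g-bal (toℚ ∘ f₂)))

take-flipAt-↑ˡ : ∀ m k (j : Fin m) (x : Cube (m +ℕ k)) → take m (flipAt (j ↑ˡ k) x) ≡ flipAt j (take m x)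
take-flipAt-↑ˡ (suc m) k F.zero    (b ∷ x) = refl
take-flipAt-↑ˡ (suc m) k (F.suc j) (b ∷ x) = cong (b ∷_) (take-flipAt-↑ˡ m k j x)

drop-flipAt-↑ˡ : ∀ m k (j : Fin m) (x : Cube (m +ℕ k)) → drop m (flipAt (j ↑ˡ k) x) ≡ drop m x
drop-flipAt-↑ˡ (suc m) k F.zero    (b ∷ x) = refl
drop-flipAt-↑ˡ (suc m) k (F.suc j) (b ∷ x) = drop-flipAt-↑ˡ m k j x

take-flipAt-↑ʳ : ∀ m k (j : Fin k) (x : Cube (m +ℕ k)) → take m (flipAt (m ↑ʳ j) x) ≡ take m x
take-flipAt-↑ʳ zero    k j x       = refl
take-flipAt-↑ʳ (suc m) k j (b ∷ x) = cong (b ∷_) (take-flipAt-↑ʳ m k j x)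

drop-flipAt-↑ʳ : ∀ m k (j : Fin k) (x : Cube (m +ℕ k)) → drop m (flipAt (m ↑ʳ j) x) ≡ flipAt j (drop m x)
drop-flipAt-↑ʳ zero    k j x       = refl
drop-flipAt-↑ʳ (suc m) k j (b ∷ x) = drop-flipAt-↑ʳ m k j x

Inf-↑ˡ : ∀ m k (H : Cube m → Cube k → Bool) (j : Fin m) →
  Inf (m +ℕ k) (λ x → H (take m x) (drop m x)) (j ↑ˡ k) ≡
  𝔼 m (λ u → Dist k (H u) (H (flipAt j u)))
Inf-↑ˡ m k H j = trans
  (𝔼-cong (m +ℕ k) (λ x → cong₂ (λ u v → ∣ toℚ (H (take m x) (drop m x)) - toℚ (H u v) ∣)
     (take-flipAt-↑ˡ m k j x) (drop-flipAt-↑ˡ m k j x)))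
  (𝔼-take-drop m k (λ u v → ∣ toℚ (H u v) - toℚ (H (flipAt j u) v) ∣))

Inf-↑ʳ : ∀ m k (H : Cube m → Cube k → Bool) (j : Fin k) →
  Inf (m +ℕ k) (λ x → H (take m x) (drop m x)) (m ↑ʳ j) ≡ 𝔼 m (λ u → Inf k (H u) j)
Inf-↑ʳ m k H j = trans
  (𝔼-cong (m +ℕ k) (λ x → cong₂ (λ u v → ∣ toℚ (H (take m x) (drop m x)) - toℚ (H u v) ∣)
     (take-flipAt-↑ʳ m k j x) (drop-flipAt-↑ʳ m k j x)))
  (𝔼-take-drop m k (λ u v → ∣ toℚ (H u v) - toℚ (H u (flipAt j v)) ∣))

blockIndex : ∀ n m → Fin n → Fin m → Fin (n *ℕ m)
blockIndex (suc n) m F.zero    j = j ↑ˡ (n *ℕ m)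
blockIndex (suc n) m (F.suc i) j = m ↑ʳ blockIndex n m i j

Inf-compose : ∀ n m f (g : Fin n → Cube m → Bool) → (∀ i → Balanced (g i)) → ∀ i j →
  Inf (n *ℕ m) (compose n m f g) (blockIndex n m i j) ≡ Inf n f i * Inf m (g i) j
Inf-compose (suc n) m f g g-bal F.zero j = begin
  Inf (m +ℕ n *ℕ m) (λ x → f (g₀ (take m x) ∷ gs (drop m x))) (j ↑ˡ n *ℕ m)
    ≡⟨ Inf-↑ˡ m (n *ℕ m) (λ u v → f (g₀ u ∷ gs v)) j ⟩
  𝔼 m (λ u → Dist (n *ℕ m) (λ v → f (g₀ u ∷ gs v)) (λ v → f (g₀ (flipAt j u) ∷ gs v)))
    ≡⟨ 𝔼-cong m (λ u → 𝔼-blockwise n m (g ∘ F.suc) (g-bal ∘ F.suc)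
                         (λ z → ∣ toℚ (f (g₀ u ∷ z)) - toℚ (f (g₀ (flipAt j u) ∷ z)) ∣)) ⟩
  𝔼 m (λ u → Dist n (f ∘ (g₀ u ∷_)) (f ∘ (g₀ (flipAt j u) ∷_)))
    ≡⟨ 𝔼-cong m (λ u → Dist-cofactors n f (g₀ u) (g₀ (flipAt j u))) ⟩
  𝔼 m (λ u → Inf (suc n) f F.zero * ∣ toℚ (g₀ u) - toℚ (g₀ (flipAt j u)) ∣)
    ≡⟨ 𝔼-*ˡ m (Inf (suc n) f F.zero) (λ u → ∣ toℚ (g₀ u) - toℚ (g₀ (flipAt j u)) ∣) ⟩
  Inf (suc n) f F.zero * Inf m g₀ j
    ∎
  where
  open ≡-Reasoning
  g₀ = g F.zero
  gs = blockwise n m (g ∘ F.suc)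
Inf-compose (suc n) m f g g-bal (F.suc i) j = begin
  Inf (m +ℕ n *ℕ m) (λ x → f (g₀ (take m x) ∷ gs (drop m x))) (m ↑ʳ blockIndex n m i j)
    ≡⟨ Inf-↑ʳ m (n *ℕ m) (λ u v → f (g₀ u ∷ gs v)) (blockIndex n m i j) ⟩
  𝔼 m (λ u → Inf (n *ℕ m) (compose n m (f ∘ (g₀ u ∷_)) (g ∘ F.suc)) (blockIndex n m i j))
    ≡⟨ 𝔼-cong m (λ u → Inf-compose n m (f ∘ (g₀ u ∷_)) (g ∘ F.suc) (g-bal ∘ F.suc) i j) ⟩
  𝔼 m (λ u → Inf n (f ∘ (g₀ u ∷_)) i * c)
    ≡⟨ 𝔼-∘-balanced m g₀ (λ b → Inf n (f ∘ (b ∷_)) i * c) (g-bal F.zero) ⟩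
  ½ * (Inf n (f ∘ (false ∷_)) i * c + Inf n (f ∘ (true ∷_)) i * c)
    ≡⟨ solve 3 (λ a b c → con ½ :* (a :* c :+ b :* c) := con ½ :* (a :+ b) :* c)
         refl (Inf n (f ∘ (false ∷_)) i) (Inf n (f ∘ (true ∷_)) i) c ⟩
  Inf (suc n) f (F.suc i) * c
    ∎
  where
  open ≡-Reasoning
  g₀ = g F.zero
  gs = blockwise n m (g ∘ F.suc)
  c = Inf m (g (F.suc i)) j

Σᶠ-blocks : ∀ n m (a : Fin (n *ℕ m) → ℚ) →
  Σᶠ (n *ℕ m) a ≡ Σᶠ n (λ i → Σᶠ m (λ j → a (blockIndex n m i j)))
Σᶠ-blocks zero    m a = refl
Σᶠ-blocks (suc n) m a = trans (Σᶠ-↑ m (n *ℕ m) a)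
  (cong (_+_ (Σᶠ m (λ j → a (j ↑ˡ n *ℕ m)))) (Σᶠ-blocks n m (λ k → a (m ↑ʳ k))))

W₁-compose : ∀ n m f₁ f₂ (g : Fin n → Cube m → Bool) → (∀ i → Balanced (g i)) →
  W₁ (n *ℕ m) (compose n m f₁ g) (compose n m f₂ g) ≡
  Σᶠ n (λ i → (Inf n f₁ i * Inf n f₂ i) * W₁ m (g i) (g i))
W₁-compose n m f₁ f₂ g g-bal = trans (Σᶠ-blocks n m _) (Σᶠ-cong n (λ i → trans
  (Σᶠ-cong m (λ j → trans
    (cong₂ _*_ (Inf-compose n m f₁ g g-bal i j) (Inf-compose n m f₂ g g-bal i j))
    (solve 3 (λ a b u → (a :* u) :* (b :* u) := (a :* b) :* (u :* u))
       refl (Inf n f₁ i) (Inf n f₂ i) (Inf m (g i) j))))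
  (Σᶠ-*ˡ m (Inf n f₁ i * Inf n f₂ i) (λ j → Inf m (g i) j * Inf m (g i) j))))

W₁-compose-bounds : ∀ n m f₁ f₂ (g : Fin n → Cube m → Bool) c₀ →
  (∀ i → Increasing (g i)) → (∀ i → Balanced (g i)) → (∀ i → c₀ ≤ W₁ m (g i) (g i)) →
  let W̃ = W₁ (n *ℕ m) (compose n m f₁ g) (compose n m f₂ g) in
  c₀ * W₁ n f₁ f₂ ≤ W̃ × W̃ ≤ W₁ n f₁ f₂
W₁-compose-bounds n m f₁ f₂ g c₀ g↑ g-bal c₀≤ =
  subst (c₀ * W₁ n f₁ f₂ ≤_) (sym W̃≡) (Σᶠ-*-lower n c₀ x s 0≤x c₀≤) ,
  subst (_≤ W₁ n f₁ f₂) (sym W̃≡) (Σᶠ-*-upper n x s 0≤x (λ i → W₁-self≤1 m (g i) (g↑ i)))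
  where
  x s : Fin n → ℚ
  x i = Inf n f₁ i * Inf n f₂ i
  s i = W₁ m (g i) (g i)
  0≤x : ∀ i → 0ℚ ≤ x i
  0≤x i = *-nonNeg (Inf-nonNeg n f₁ i) (Inf-nonNeg n f₂ i)
  W̃≡ : W₁ (n *ℕ m) (compose n m f₁ g) (compose n m f₂ g) ≡ Σᶠ n (λ i → x i * s i)
  W̃≡ = W₁-compose n m f₁ f₂ g g-bal

-- Partial sums of the exponential series

-- k + 1 as an explicit mkℚ: unlike + suc k / 1, its reciprocal reduces.
sucℚ : ℕ → ℚ
sucℚ k = mkℚ (+ suc k) 0 (Coprimality.sym (Coprimality.1-coprimeTo (suc k)))

sucℚ-suc : ∀ k → sucℚ (suc k) ≡ sucℚ k + 1ℚ
sucℚ-suc k = ℚ.toℚᵘ-injective (ℚᵘ.≃-trans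
  (ℚᵘ.*≡* (cong (λ n → + suc n) (trans (ℕ.+-comm 1 (k *ℕ 1)) (sym (ℕ.*-identityʳ _)))))
  (ℚᵘ.≃-sym (ℚ.toℚᵘ-homo-+ (sucℚ k) 1ℚ)))

sucℚ*1/suc : ∀ k → sucℚ k * (+ 1 / suc k) ≡ 1ℚ
sucℚ*1/suc k = trans (cong (sucℚ k *_) (ℚ.normalize-coprime (Coprimality.1-coprimeTo (suc k))))
  (ℚ.*-inverseʳ (sucℚ k))

sucℚ*expTerm-suc : ∀ k x → sucℚ k * expTerm (suc k) x ≡ expTerm k x * x
sucℚ*expTerm-suc k x = begin
  sucℚ k * (expTerm k x * x * q)  ≡⟨ solve 4 (λ n t x q → n :* (t :* x :* q) := t :* x :* (n :* q))
                                        refl (sucℚ k) (expTerm k x) x q ⟩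
  expTerm k x * x * (sucℚ k * q)  ≡⟨ cong (expTerm k x * x *_) (sucℚ*1/suc k) ⟩
  expTerm k x * x * 1ℚ            ≡⟨ ℚ.*-identityʳ _ ⟩
  expTerm k x * x                 ∎
  where
  open ≡-Reasoning
  q = + 1 / suc k

expTerm-nonNeg : ∀ k {x} → 0ℚ ≤ x → 0ℚ ≤ expTerm k x
expTerm-nonNeg zero    0≤x = ℚ.<⇒≤ 0<1
expTerm-nonNeg (suc k) 0≤x = *-nonNeg (*-nonNeg (expTerm-nonNeg k 0≤x) 0≤x)
  (ℚ.nonNegative⁻¹ (+ 1 / suc k) {{ℚ.normalize-nonNeg 1 (suc k)}})

expPartial-nonNeg : ∀ N {x} → 0ℚ ≤ x → 0ℚ ≤ expPartial N x
expPartial-nonNeg zero    0≤x = ℚ.<⇒≤ 0<1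
expPartial-nonNeg (suc N) 0≤x = +-nonNeg (expPartial-nonNeg N 0≤x) (expTerm-nonNeg (suc N) 0≤x)

expPartial-≤-suc : ∀ N {x} → 0ℚ ≤ x → expPartial N x ≤ expPartial (suc N) x
expPartial-≤-suc N {x} 0≤x = ≤-byDiff (expTerm (suc N) x)
  (solve 2 (λ s t → s :+ t :- s := t) refl (expPartial N x) (expTerm (suc N) x))
  (expTerm-nonNeg (suc N) 0≤x)

-- The first two terms of the binomial expansion of (x + y)^(k+1)/(k+1)!.
expTerm-shift : ∀ k {x y} → 0ℚ ≤ x → 0ℚ ≤ y →
  expTerm (suc k) x + y * expTerm k x ≤ expTerm (suc k) (x + y)
expTerm-shift zero    {x} {y} _ _ = ℚ.≤-reflexive
  (solve 2 (λ x y → con 1ℚ :* x :* con 1ℚ :+ y :* con 1ℚ := con 1ℚ :* (x :+ y) :* con 1ℚ) refl x y)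
expTerm-shift (suc k) {x} {y} 0≤x 0≤y = let open ℚ.≤-Reasoning in begin
  t′ * x * q + y * t′
    ≤⟨ ≤-byDiff (y * y * t * q) gap
         (*-nonNeg (*-nonNeg (*-nonNeg 0≤y 0≤y) (expTerm-nonNeg k 0≤x)) (ℚ.<⇒≤ 0<q)) ⟩
  (t′ + y * t) * (x + y) * q
    ≤⟨ ℚ.*-monoʳ-≤-nonNeg q {{nonNegative (ℚ.<⇒≤ 0<q)}}
         (ℚ.*-monoʳ-≤-nonNeg (x + y) {{nonNegative (+-nonNeg 0≤x 0≤y)}} (expTerm-shift k 0≤x 0≤y)) ⟩
  expTerm (suc k) (x + y) * (x + y) * q
    ∎
  where
  t  = expTerm k x
  t′ = expTerm (suc k) x
  q  = + 1 / suc (suc k)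
  0<q : 0ℚ < q
  0<q = ℚ.positive⁻¹ q {{ℚ.normalize-pos 1 (suc (suc k))}}
  cancel : t′ * q + t * x * q - t′ ≡ 0ℚ
  cancel = begin
    t′ * q + t * x * q - t′         ≡⟨ cong (λ z → t′ * q + z * q - t′) (sucℚ*expTerm-suc k x) ⟨
    t′ * q + sucℚ k * t′ * q - t′   ≡⟨ solve 3 (λ t′ n q → t′ :* q :+ n :* t′ :* q :- t′
                                                      := t′ :* ((n :+ con 1ℚ) :* q :- con 1ℚ))
                                         refl t′ (sucℚ k) q ⟩
    t′ * ((sucℚ k + 1ℚ) * q - 1ℚ)   ≡⟨ cong (λ n → t′ * (n * q - 1ℚ)) (sucℚ-suc k) ⟨
    t′ * (sucℚ (suc k) * q - 1ℚ)    ≡⟨ cong (λ z → t′ * (z - 1ℚ)) (sucℚ*1/suc (suc k)) ⟩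
    t′ * (1ℚ - 1ℚ)                  ≡⟨ ℚ.*-zeroʳ t′ ⟩
    0ℚ                              ∎
    where open ≡-Reasoning
  gap : (t′ + y * t) * (x + y) * q - (t′ * x * q + y * t′) ≡ y * y * t * q
  gap = begin
    (t′ + y * t) * (x + y) * q - (t′ * x * q + y * t′)
      ≡⟨ solve 5 (λ t t′ x y q → (t′ :+ y :* t) :* (x :+ y) :* q :- (t′ :* x :* q :+ y :* t′)
                     := y :* y :* t :* q :+ y :* (t′ :* q :+ t :* x :* q :- t′)) refl t t′ x y q ⟩
    y * y * t * q + y * (t′ * q + t * x * q - t′)
      ≡⟨ cong (λ z → y * y * t * q + y * z) cancel ⟩
    y * y * t * q + y * 0ℚ
      ≡⟨ solve 3 (λ y t q → y :* y :* t :* q :+ y :* con 0ℚ := y :* y :* t :* q) refl y t q ⟩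
    y * y * t * q
      ∎
    where open ≡-Reasoning

expPartial-shift : ∀ N {x y} → 0ℚ ≤ x → 0ℚ ≤ y →
  expPartial (suc N) x + y * expPartial N x ≤ expPartial (suc N) (x + y)
expPartial-shift zero    {x} {y} 0≤x 0≤y = ℚ.≤-trans
  (ℚ.≤-reflexive (solve 2 (λ t y → con 1ℚ :+ t :+ y :* con 1ℚ := con 1ℚ :+ (t :+ y :* con 1ℚ))
     refl (expTerm 1 x) y))
  (ℚ.+-monoʳ-≤ 1ℚ (expTerm-shift 0 0≤x 0≤y))
expPartial-shift (suc N) {x} {y} 0≤x 0≤y = ℚ.≤-trans
  (ℚ.≤-reflexive (solve 4 (λ s t t′ y → (s :+ t′ :+ t) :+ y :* (s :+ t′)
                                       := (s :+ t′ :+ y :* s) :+ (t :+ y :* t′))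
     refl (expPartial N x) (expTerm (suc (suc N)) x) (expTerm (suc N) x) y))
  (ℚ.+-mono-≤ (expPartial-shift N 0≤x 0≤y) (expTerm-shift (suc N) 0≤x 0≤y))

expPartial-growth : ∀ N {x y} → 0ℚ ≤ x → 0ℚ ≤ y →
  (1ℚ + y) * expPartial N x ≤ expPartial (suc N) (x + y)
expPartial-growth N {x} {y} 0≤x 0≤y = begin
  (1ℚ + y) * expPartial N x                ≡⟨ solve 2 (λ y s → (con 1ℚ :+ y) :* s := s :+ y :* s)
                                                 refl y (expPartial N x) ⟩
  expPartial N x + y * expPartial N x      ≤⟨ ℚ.+-monoˡ-≤ (y * expPartial N x) (expPartial-≤-suc N 0≤x) ⟩
  expPartial (suc N) x + y * expPartial N x ≤⟨ expPartial-shift N 0≤x 0≤y ⟩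
  expPartial (suc N) (x + y)               ∎
  where open ℚ.≤-Reasoning

-- Rescaling a φ-bound

-- v ≤ exp x, with exp x = sup_N S_N(x) for x ≥ 0, as in the second clause of ExpLE.
infix 4 _≤exp_
_≤exp_ : ℚ → ℚ → Set
v ≤exp x = ∀ ε → 0ℚ < ε → ∃ λ N → v - ε < expPartial N x

≤exp-antimono : ∀ {v v′ x} → v′ ≤ v → v ≤exp x → v′ ≤exp x
≤exp-antimono v′≤v v≤expx ε 0<ε with v≤expx ε 0<ε
... | N , v-ε<S = N , ℚ.≤-<-trans (ℚ.+-monoˡ-≤ (- ε) v′≤v) v-ε<S

≤exp-growth : ∀ {v x y r} → 0ℚ ≤ x → 0ℚ ≤ y → (0<r : 0ℚ < r) → r ≤ 1ℚ + y →
  v ≤exp x → r * v ≤exp (x + y)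
≤exp-growth {v} {x} {y} {r} 0≤x 0≤y 0<r r≤1+y v≤expx ε 0<ε =
  shift (v≤expx (ε * r⁻¹) (*-pos 0<ε (1/-pos 0<r)))
  where
  r⁻¹ = (1/ r) {{>-nonZero 0<r}}
  r[v-ε/r] : r * (v - ε * r⁻¹) ≡ r * v - ε
  r[v-ε/r] = begin
    r * (v - ε * r⁻¹)     ≡⟨ solve 4 (λ r v ε s → r :* (v :- ε :* s) := r :* v :- ε :* (r :* s))
                                 refl r v ε r⁻¹ ⟩
    r * v - ε * (r * r⁻¹) ≡⟨ cong (λ z → r * v - ε * z) (ℚ.*-inverseʳ r {{>-nonZero 0<r}}) ⟩
    r * v - ε * 1ℚ        ≡⟨ cong (λ z → r * v - z) (ℚ.*-identityʳ ε) ⟩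
    r * v - ε             ∎
    where open ≡-Reasoning
  shift : (∃ λ N → v - ε * r⁻¹ < expPartial N x) → ∃ λ N → r * v - ε < expPartial N (x + y)
  shift (N , v-ε/r<S) = suc N , (begin-strict
    r * v - ε                 ≡⟨ r[v-ε/r] ⟨
    r * (v - ε * r⁻¹)         <⟨ ℚ.*-monoʳ-<-pos r {{positive 0<r}} v-ε/r<S ⟩
    r * expPartial N x        ≤⟨ ℚ.*-monoʳ-≤-nonNeg (expPartial N x) {{nonNegative (expPartial-nonNeg N 0≤x)}}
                                     r≤1+y ⟩
    (1ℚ + y) * expPartial N x ≤⟨ expPartial-growth N 0≤x 0≤y ⟩
    expPartial (suc N) (x + y) ∎)
    where open ℚ.≤-Reasoning

1≤exp : ∀ x → 1ℚ ≤exp x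
1≤exp x ε 0<ε = 0 , <-byDiff ε (solve 1 (λ ε → con 1ℚ :- (con 1ℚ :- ε) := ε) refl ε) 0<ε

1<expPartial-1-1 : 1ℚ < expPartial 1 1ℚ
1<expPartial-1-1 = toWitness {a? = 1ℚ ℚ.<? expPartial 1 1ℚ} _

≤1⇒LtE : ∀ {w} → w ≤ 1ℚ → LtE w
≤1⇒LtE w≤1 = 1 , ℚ.≤-<-trans w≤1 1<expPartial-1-1

GtE⇒1< : ∀ {w} → GtE w → 1ℚ < w
GtE⇒1< (ε , 0<ε , S+ε≤w) = ℚ.<-≤-trans
  (ℚ.<-trans 1<expPartial-1-1 (<-byDiff ε (solve 2 (λ s ε → s :+ ε :- s := ε) refl (expPartial 1 1ℚ) ε) 0<ε))
  (S+ε≤w 1)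

ExpLE-≤1 : ∀ {a w} (0<w : 0ℚ < w) → w ≤ 1ℚ → ExpLE a w → a ≤ 0ℚ × (1/ w) {{>-nonZero 0<w}} ≤exp - a
ExpLE-≤1 {a} {w} 0<w w≤1 (inj₁ (_ , S≤w)) = a≤0 , ≤exp-antimono 1/w≤1 (1≤exp (- a))
  where
  a≤0 : a ≤ 0ℚ
  a≤0 = ≤-byDiff (1ℚ - expPartial 1 a)
    (solve 1 (λ a → con 0ℚ :- a := con 1ℚ :- (con 1ℚ :+ con 1ℚ :* a :* con 1ℚ)) refl a)
    (p≤q⇒0≤q-p (ℚ.≤-trans (S≤w 1) w≤1))
  1/w≤1 : (1/ w) {{>-nonZero 0<w}} ≤ 1ℚ
  1/w≤1 = 1/-≤ 0<w (subst (1ℚ ≤_) (sym (ℚ.*-identityʳ w)) (S≤w 0))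
ExpLE-≤1 0<w w≤1 (inj₂ (a<0 , _ , 1/w≤exp)) = ℚ.<⇒≤ a<0 , 1/w≤exp

exponent-gap : ∀ {A A′ r} → 0ℚ < r → 1ℚ - A ≤ 0ℚ → (1ℚ + r) * A ≤ A′ → r ≤ A′ - A × 1ℚ - A′ < 0ℚ
exponent-gap {A} {A′} {r} 0<r 1-A≤0 [1+r]A≤A′ =
  ≤-byDiff (d + r * - (1ℚ - A))
    (solve 3 (λ A A′ r → A′ :- A :- r := (A′ :- (con 1ℚ :+ r) :* A) :+ r :* :- (con 1ℚ :- A)) refl A A′ r)
    (+-nonNeg 0≤d (*-nonNeg (ℚ.<⇒≤ 0<r) 0≤A-1)) ,
  <-byDiff (d + (1ℚ + r) * - (1ℚ - A) + r)
    (solve 3 (λ A A′ r → con 0ℚ :- (con 1ℚ :- A′)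
                           := (A′ :- (con 1ℚ :+ r) :* A) :+ (con 1ℚ :+ r) :* :- (con 1ℚ :- A) :+ r)
       refl A A′ r)
    (ℚ.+-mono-≤-< (+-nonNeg 0≤d (*-nonNeg (ℚ.<⇒≤ (ℚ.+-mono-<-≤ 0<1 (ℚ.<⇒≤ 0<r))) 0≤A-1)) 0<r)
  where
  d = A′ - (1ℚ + r) * A
  0≤d = p≤q⇒0≤q-p [1+r]A≤A′
  0≤A-1 : 0ℚ ≤ - (1ℚ - A)
  0≤A-1 = ℚ.neg-antimono-≤ 1-A≤0

ExpLE-rescale : ∀ {K r W W̃ C} (0<C : 0ℚ < C) → 0ℚ < K → 0ℚ < r → (0<W : 0ℚ < W) → (0<W̃ : 0ℚ < W̃) →
  W ≤ r * W̃ → W ≤ 1ℚ →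
  ExpLE (1ℚ - (K * W ÷ C) {{>-nonZero 0<C}}) W →
  ExpLE (1ℚ - (K * (1ℚ + r) * r * W̃ ÷ C) {{>-nonZero 0<C}}) W̃
ExpLE-rescale {K} {r} {W} {W̃} {C} 0<C 0<K 0<r 0<W 0<W̃ W≤rW̃ W≤1 expLE =
  inj₂ (1-A′<0 , 0<W̃ , ≤exp-antimono (1/≤*1/ {r = r} 0<W 0<W̃ W≤rW̃)
    (subst (r * (1/ W) {{>-nonZero 0<W}} ≤exp_) exponent≡ (≤exp-growth 0≤A-1 0≤y 0<r r≤1+y 1/W≤exp)))
  where
  C⁻¹ = (1/ C) {{>-nonZero 0<C}}
  A  = K * W * C⁻¹
  A′ = K * (1ℚ + r) * r * W̃ * C⁻¹
  0<1+r = ℚ.+-mono-<-≤ 0<1 (ℚ.<⇒≤ 0<r)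
  1-A≤0 = proj₁ (ExpLE-≤1 0<W W≤1 expLE)
  1/W≤exp = proj₂ (ExpLE-≤1 0<W W≤1 expLE)
  [1+r]A≤A′ : (1ℚ + r) * A ≤ A′
  [1+r]A≤A′ = ≤-byDiff (K * (1ℚ + r) * C⁻¹ * (r * W̃ - W))
    (solve 5 (λ K r W W̃ c → K :* (con 1ℚ :+ r) :* r :* W̃ :* c :- (con 1ℚ :+ r) :* (K :* W :* c)
                          := K :* (con 1ℚ :+ r) :* c :* (r :* W̃ :- W))
       refl K r W W̃ C⁻¹)
    (*-nonNeg (*-nonNeg (*-nonNeg (ℚ.<⇒≤ 0<K) (ℚ.<⇒≤ 0<1+r)) (ℚ.<⇒≤ (1/-pos 0<C))) (p≤q⇒0≤q-p W≤rW̃))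
  r≤y = proj₁ (exponent-gap 0<r 1-A≤0 [1+r]A≤A′)
  1-A′<0 = proj₂ (exponent-gap 0<r 1-A≤0 [1+r]A≤A′)
  0≤A-1 : 0ℚ ≤ - (1ℚ - A)
  0≤A-1 = ℚ.neg-antimono-≤ 1-A≤0
  0≤y : 0ℚ ≤ A′ - A
  0≤y = ℚ.≤-trans (ℚ.<⇒≤ 0<r) r≤y
  r≤1+y : r ≤ 1ℚ + (A′ - A)
  r≤1+y = ℚ.≤-trans r≤y
    (≤-byDiff 1ℚ (solve 1 (λ y → con 1ℚ :+ y :- y := con 1ℚ) refl (A′ - A)) (ℚ.<⇒≤ 0<1))
  exponent≡ : - (1ℚ - A) + (A′ - A) ≡ - (1ℚ - A′)
  exponent≡ = solve 2 (λ A A′ → :- (con 1ℚ :- A) :+ (A′ :- A) := :- (con 1ℚ :- A′)) refl A A′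

φBound-rescale : ∀ {K r W W̃ C} → 0ℚ < K → 0ℚ < r → 0ℚ ≤ W̃ → W ≤ r * W̃ → W̃ ≤ W → W ≤ 1ℚ →
  φBound K W C → φBound (K * (1ℚ + r) * r) W̃ C
φBound-rescale {W̃ = W̃} _ _ 0≤W̃ _ W̃≤W _ (inj₁ (W≡0 , C≤0)) =
  inj₁ (ℚ.≤-antisym (subst (W̃ ≤_) W≡0 W̃≤W) 0≤W̃ , C≤0)
φBound-rescale _ _ _ _ _ W≤1 (inj₂ (inj₂ (e<W , _))) =
  ⊥-elim (ℚ.<-irrefl refl (ℚ.<-≤-trans (GtE⇒1< e<W) W≤1))
φBound-rescale _ 0<r _ W≤rW̃ W̃≤W W≤1 (inj₂ (inj₁ (0<W , _ , inj₁ C≤0))) =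
  inj₂ (inj₁ (≤*⇒pos 0<r 0<W W≤rW̃ , ≤1⇒LtE (ℚ.≤-trans W̃≤W W≤1) , inj₁ C≤0))
φBound-rescale 0<K 0<r _ W≤rW̃ W̃≤W W≤1 (inj₂ (inj₁ (0<W , _ , inj₂ (0<C , expLE)))) =
  inj₂ (inj₁ (0<W̃ , ≤1⇒LtE (ℚ.≤-trans W̃≤W W≤1) ,
              inj₂ (0<C , ExpLE-rescale 0<C 0<K 0<r 0<W 0<W̃ W≤rW̃ W≤1 expLE)))
  where
  0<W̃ = ≤*⇒pos 0<r 0<W W≤rW̃

mainTheorem8 : (K c₀ : ℚ) → 0ℚ < K → 0ℚ < c₀ →
    Σ ℚ (λ K′ → 0ℚ < K′ ×
      ((n m : ℕ) (f₁ f₂ : Cube n → Bool) (g : Fin n → Cube m → Bool) →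
       Increasing f₁ → Increasing f₂ →
       Tight n K f₁ f₂ →
       ((i : Fin n) → Increasing (g i)) →
       ((i : Fin n) → 𝔼 m (λ x → toℚ (g i x)) ≡ ½) →
       ((i : Fin n) → c₀ ≤ Σᶠ m (λ j → Inf m (g i) j * Inf m (g i) j)) →
       Tight (n *ℕ m) K′ (compose n m f₁ g) (compose n m f₂ g)))
mainTheorem8 K c₀ 0<K 0<c₀ = K * (1ℚ + r) * r , 0<K′ ,
  λ n m f₁ f₂ g f₁↑ f₂↑ tight g↑ g-bal c₀≤ →
    let W̃ = W₁ (n *ℕ m) (compose n m f₁ g) (compose n m f₂ g)
        c₀W≤W̃ , W̃≤W = W₁-compose-bounds n m f₁ f₂ g c₀ g↑ g-bal c₀≤
    in subst (φBound (K * (1ℚ + r) * r) W̃) (sym (Cov-compose n m f₁ f₂ g g-bal))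
         (φBound-rescale 0<K 0<r (W₁-nonNeg (n *ℕ m) (compose n m f₁ g) (compose n m f₂ g))
            (*≤⇒≤1/* 0<c₀ c₀W≤W̃) W̃≤W (W₁≤1 n f₁ f₂ f₁↑ f₂↑) tight)
  where
  r = (1/ c₀) {{>-nonZero 0<c₀}}
  0<r = 1/-pos 0<c₀
  0<K′ = *-pos (*-pos 0<K (ℚ.+-mono-<-≤ 0<1 (ℚ.<⇒≤ 0<r))) 0<r
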